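{- For any positive integers $a,b,c$, the matrix multiplication tensor satisfies $\tilde S(\langle a,b,c\rangle)=abc/\max\{a,b,c\}$.
   Context: Tensors over a field $\mathbb{F}$; $\langle a,b,c\rangle=\sum_{i\in[a],j\in[b],k\in[c]}x_{ij}y_{jk}z_{ki}$ over variable sets $\{x_{ij}\},\{y_{jk}\},\{z_{ki}\}$. Tensor powers $T^{\otimes n}$ are over $X^n,Y^n,Z^n$ with coordinatewise-multiplied coefficients. $T$ has x-rank 1 if $T=(\sum_x\alpha_xx)\otimes(\sum_{y,z}\beta_{yz}yz)$; $S_x(T)$ is the least number of x-rank-1 tensors summing to $T$; $S_y,S_z$ analogously; the slice rank $S(T)$ is the minimum of $S_x(T_X)+S_y(T_Y)+S_z(T_Z)$ over $T=T_X+T_Y+T_Z$; the asymptotic slice rank is $\tilde S(T)=\limsup_{n}S(T^{\otimes n})^{1/n}$. -}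

module Defs where

open import Level using (Level; _⊔_)
open import Algebra.Bundles using (CommutativeRing)
open import Data.Nat as ℕ using (ℕ; zero; suc)
open import Data.Fin using (Fin; zero; suc; _≟_)
open import Data.Vec using (Vec; []; _∷_)
open import Data.Product using (Σ; ∃; ∃-syntax; _×_; _,_)
open import Relation.Nullary using (¬_; does)
open import Data.Bool using (Bool; true; false; _∧_; if_then_else_)
open import Relation.Binary.PropositionalEquality using (_≡_)

IsField : ∀ {c ℓ} → CommutativeRing c ℓ → Set (c Level.⊔ ℓ)
IsField F = (¬ (1# ≈ 0#)) × (∀ x → ¬ (x ≈ 0#) → ∃[ y ] (x * y ≈ 1#))
  where open CommutativeRing F using (_≈_; _*_; 0#; 1#)

module _ {c ℓ} (F : CommutativeRing c ℓ) where
  open CommutativeRing F using (Carrier; _≈_; _+_; _*_; 0#; 1#)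

  Tensor : Set → Set → Set → Set c
  Tensor X Y Z = X → Y → Z → Carrier

  ∑ : (r : ℕ) → (Fin r → Carrier) → Carrier
  ∑ zero    f = 0#
  ∑ (suc r) f = f zero + ∑ r (λ i → f (suc i))

  ∏ : ∀ {A : Set} {n} → (A → Carrier) → Vec A n → Carrier
  ∏ f []       = 1#
  ∏ f (a ∷ as) = f a * ∏ f as

  tensorPow : ∀ {X Y Z} → Tensor X Y Z → (n : ℕ) → Tensor (Vec X n) (Vec Y n) (Vec Z n)
  tensorPow T zero    []       []       []       = 1#
  tensorPow T (suc n) (x ∷ xs) (y ∷ ys) (z ∷ zs) = T x y z * tensorPow T n xs ys zs

  -- S(T) ≤ r  iff  SliceDecomp T r' holds for some r' ≤ r.
  record SliceDecomp {X Y Z : Set} (T : Tensor X Y Z) (r : ℕ) : Set c where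
    field
      r₁ r₂ r₃ : ℕ
      total    : r₁ ℕ.+ r₂ ℕ.+ r₃ ≡ r
      αx : Fin r₁ → X → Carrier
      βx : Fin r₁ → Y → Z → Carrier
      αy : Fin r₂ → Y → Carrier
      βy : Fin r₂ → X → Z → Carrier
      αz : Fin r₃ → Z → Carrier
      βz : Fin r₃ → X → Y → Carrier

  SliceDecompValid : {X Y Z : Set} (T : Tensor X Y Z) (r : ℕ) → SliceDecomp T r → Set ℓ
  SliceDecompValid {X} {Y} {Z} T r d =
      ∀ (x : X) (y : Y) (z : Z) →
        T x y z ≈ (∑ r₁ (λ i → αx i x * βx i y z)
                 + ∑ r₂ (λ i → αy i y * βy i x z))
                 + ∑ r₃ (λ i → αz i z * βz i x y)
    where open SliceDecomp d

  -- T has a slice decomposition with exactly r rank-one summands (equivalently S(T) ≤ r,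
  -- since zero summands may be added).
  HasSliceRankDecomp : {X Y Z : Set} → Tensor X Y Z → ℕ → Set (c Level.⊔ ℓ)
  HasSliceRankDecomp T r = Σ (SliceDecomp T r) (SliceDecompValid T r)

  δ : ∀ {m} → Fin m → Fin m → Carrier
  δ i j = if does (i ≟ j) then 1# else 0#

  -- The matrix multiplication tensor ⟨a,b,c⟩ = ∑ x_{ij} y_{jk} z_{ki}, with
  -- X = [a]×[b], Y = [b]×[c], Z = [c]×[a].
  MM : (a b c : ℕ) → Tensor (Fin a × Fin b) (Fin b × Fin c) (Fin c × Fin a)
  MM a b c (i , j) (j' , k) (k' , i') = (δ j j' * δ k k') * δ i i'

module Submission where

-- ⟨a,b,c⟩ has asymptotic slice rank M = abc / max{a,b,c}: we prove S(⟨a,b,c⟩^{⊗n}) = M^n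
-- exactly for every n, and both halves of the corollary follow by arithmetic on rationals.
-- Rotating the coordinates preserves slice rank, so we may take c to be the largest dimension.
--
-- Upper bound: the n-th power has (ab)^n x-slices.
-- Lower bound: the monomials x_{ij} y_{jk} z_{ki} with k = (i + j) mod c form a triangulated
-- diagonal of length ab (no other monomial lies weakly below a diagonal one in three suitable
-- total orders), and triangulations pass to tensor powers under lexicographic orders. The core
-- bound: a triangulated diagonal of length m forces ≥ m summands. Gaussian elimination with
-- label-minimal pivots gives, off at most r₁ pivots, unit-triangular vectors annihilating the
-- r₁ x-slice functionals (likewise for y, z); if r < m a diagonal point is a pivot of none, and
-- contracting T against its three vectors gives 1 by triangularity but 0 by the decomposition.

open import Defs
open import Algebra.Bundles using (CommutativeRing)
open import Data.Nat as ℕ using (ℕ; zero; suc; z≤n; s≤s; NonZero)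
import Data.Nat.Properties as ℕ
open import Data.Nat.DivMod using (_%_; _mod_; m%n<n; m<n⇒m%n≡m; [m+kn]%n≡m%n; %-distribˡ-+)
open import Data.Fin using (Fin; zero; suc; _≟_; toℕ; combine; remQuot)
import Data.Fin.Properties as Fin
open import Data.List using (List; []; _∷_; length; _++_; lookup)
import Data.List.Properties as List
open import Data.List.Relation.Unary.All as All using (All; []; _∷_)
open import Data.List.Relation.Unary.Any using (here; there; index; any?)
open import Data.List.Relation.Unary.Any.Properties using (lookup-index)
open import Data.List.Membership.Propositional using (_∉_)
open import Data.List.Membership.Propositional.Properties using (∈-++⁺ˡ; ∈-++⁺ʳ)
open import Data.Vec using (Vec; []; _∷_; map)
open import Data.Vec.Properties using (∷-injective)
import Data.Vec.Relation.Binary.Lex.Strict as VecLex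
open import Data.Vec.Relation.Binary.Pointwise.Inductive using (_∷_)
open import Data.Product using (Σ; ∃-syntax; _×_; _,_; proj₁; proj₂)
open import Data.Product.Relation.Binary.Lex.Strict using (×-strictTotalOrder)
open import Data.Sum using (_⊎_; inj₁; inj₂; [_,_])
open import Data.Empty using (⊥; ⊥-elim)
open import Data.Bool using (if_then_else_)
open import Function using (_∘_)
open import Function.Bundles using (_↔_; Inverse; Injection; mk↔ₛ′)
open import Function.Definitions using (Injective)
open import Function.Properties.Inverse using (↔⇒↣)
open import Level using (0ℓ) renaming (_⊔_ to _⊔ˡ_; suc to lsuc)
open import Relation.Binary.Core using (Rel)
open import Relation.Binary.Bundles using (StrictTotalOrder)
open import Relation.Binary.Definitions using (tri<; tri≈; tri>)
import Relation.Binary.Construct.StrictToNonStrict as StrictToNonStrict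
import Relation.Binary.Construct.Flip.EqAndOrd as Flip
open import Relation.Nullary using (¬_; Dec; yes; no)
open import Relation.Nullary.Negation using (DoubleNegation)
open import Relation.Nullary.Decidable using (¬¬-excluded-middle; dec-true; dec-false)
import Relation.Binary.PropositionalEquality as ≡
open ≡ using (_≡_; _≢_)

module Combinations {c ℓ} (F : CommutativeRing c ℓ) where
  open CommutativeRing F hiding (zero)
  open import Algebra.Properties.Semiring.Sum semiring
    using (sum; sum-cong-≋; ∑-distrib-+; *-distribˡ-sum)
  open import Algebra.Properties.CommutativeSemigroup +-commutativeSemigroup
    using (interchange)
  open import Relation.Binary.Reasoning.Setoid setoid

  ∑≡sum : ∀ r (f : Fin r → Carrier) → ∑ F r f ≡.≡ sum f
  ∑≡sum zero    f = ≡.refl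
  ∑≡sum (suc r) f = ≡.cong (f zero +_) (∑≡sum r (f ∘ suc))

  ∑-cong : ∀ r {f g : Fin r → Carrier} → (∀ i → f i ≈ g i) → ∑ F r f ≈ ∑ F r g
  ∑-cong r {f} {g} f≈g = begin
    ∑ F r f ≡⟨ ∑≡sum r f ⟩
    sum f   ≈⟨ sum-cong-≋ f≈g ⟩
    sum g   ≡⟨ ≡.sym (∑≡sum r g) ⟩
    ∑ F r g ∎

  ∑-+ : ∀ r (f g : Fin r → Carrier) → ∑ F r (λ i → f i + g i) ≈ ∑ F r f + ∑ F r g
  ∑-+ r f g = begin
    ∑ F r (λ i → f i + g i) ≡⟨ ∑≡sum r _ ⟩
    sum (λ i → f i + g i)   ≈⟨ ∑-distrib-+ f g ⟩
    sum f + sum g           ≡⟨ ≡.sym (≡.cong₂ _+_ (∑≡sum r f) (∑≡sum r g)) ⟩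
    ∑ F r f + ∑ F r g       ∎

  ∑-*ˡ : ∀ r k (f : Fin r → Carrier) → ∑ F r (λ i → k * f i) ≈ k * ∑ F r f
  ∑-*ˡ r k f = begin
    ∑ F r (λ i → k * f i) ≡⟨ ∑≡sum r _ ⟩
    sum (λ i → k * f i)   ≈⟨ sym (*-distribˡ-sum k f) ⟩
    k * sum f             ≡⟨ ≡.cong (k *_) (≡.sym (∑≡sum r f)) ⟩
    k * ∑ F r f           ∎

  ∑-vanish : ∀ r {f : Fin r → Carrier} → (∀ i → f i ≈ 0#) → ∑ F r f ≈ 0#
  ∑-vanish zero    f≈0 = refl
  ∑-vanish (suc r) f≈0 = trans (+-cong (f≈0 zero) (∑-vanish r (f≈0 ∘ suc))) (+-identityˡ 0#)

  -- A formal linear combination ∑ cₚ·p of points p : A, paired with a function f on A.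
  ⟪_∣_⟫ : ∀ {A : Set} → List (A × Carrier) → (A → Carrier) → Carrier
  ⟪ []            ∣ f ⟫ = 0#
  ⟪ (p , cₚ) ∷ L ∣ f ⟫ = cₚ * f p + ⟪ L ∣ f ⟫

  module _ {A : Set} where

    ⟪⟫-cong : ∀ (L : List (A × Carrier)) {f g : A → Carrier} →
              (∀ p → f p ≈ g p) → ⟪ L ∣ f ⟫ ≈ ⟪ L ∣ g ⟫
    ⟪⟫-cong []            f≈g = refl
    ⟪⟫-cong ((p , _) ∷ L) f≈g = +-cong (*-congˡ (f≈g p)) (⟪⟫-cong L f≈g)

    ⟪⟫-vanish : ∀ (L : List (A × Carrier)) {f : A → Carrier} →
                All (λ e → f (proj₁ e) ≈ 0#) L → ⟪ L ∣ f ⟫ ≈ 0#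
    ⟪⟫-vanish []             []           = refl
    ⟪⟫-vanish ((p , cₚ) ∷ L) {f} (fp≈0 ∷ f≈0) = begin
      cₚ * f p + ⟪ L ∣ f ⟫ ≈⟨ +-cong (*-congˡ fp≈0) (⟪⟫-vanish L f≈0) ⟩
      cₚ * 0# + 0#         ≈⟨ +-identityʳ _ ⟩
      cₚ * 0#              ≈⟨ zeroʳ cₚ ⟩
      0#                   ∎

    ⟪⟫-zero : ∀ (L : List (A × Carrier)) {f : A → Carrier} → (∀ p → f p ≈ 0#) → ⟪ L ∣ f ⟫ ≈ 0#
    ⟪⟫-zero L f≈0 = ⟪⟫-vanish L (All.tabulate (λ _ → f≈0 _))

    ⟪⟫-+ : ∀ (L : List (A × Carrier)) (f g : A → Carrier) →
           ⟪ L ∣ (λ p → f p + g p) ⟫ ≈ ⟪ L ∣ f ⟫ + ⟪ L ∣ g ⟫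
    ⟪⟫-+ []             f g = sym (+-identityˡ 0#)
    ⟪⟫-+ ((p , cₚ) ∷ L) f g =
      trans (+-cong (distribˡ cₚ (f p) (g p)) (⟪⟫-+ L f g)) (interchange _ _ _ _)

    ⟪⟫-*ʳ : ∀ (L : List (A × Carrier)) k (f : A → Carrier) →
            ⟪ L ∣ (λ p → f p * k) ⟫ ≈ ⟪ L ∣ f ⟫ * k
    ⟪⟫-*ʳ []             k f = sym (zeroˡ k)
    ⟪⟫-*ʳ ((p , cₚ) ∷ L) k f =
      trans (+-cong (sym (*-assoc cₚ (f p) k)) (⟪⟫-*ʳ L k f)) (sym (distribʳ k _ _))

    ⟪⟫-*ˡ : ∀ (L : List (A × Carrier)) k (f : A → Carrier) →
            ⟪ L ∣ (λ p → k * f p) ⟫ ≈ k * ⟪ L ∣ f ⟫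
    ⟪⟫-*ˡ L k f = begin
      ⟪ L ∣ (λ p → k * f p) ⟫ ≈⟨ ⟪⟫-cong L (λ p → *-comm k (f p)) ⟩
      ⟪ L ∣ (λ p → f p * k) ⟫ ≈⟨ ⟪⟫-*ʳ L k f ⟩
      ⟪ L ∣ f ⟫ * k           ≈⟨ *-comm _ k ⟩
      k * ⟪ L ∣ f ⟫           ∎

    ⟪⟫-∑ : ∀ (L : List (A × Carrier)) r (h : Fin r → A → Carrier) →
           ⟪ L ∣ (λ p → ∑ F r (λ i → h i p)) ⟫ ≈ ∑ F r (λ i → ⟪ L ∣ h i ⟫)
    ⟪⟫-∑ []             r h = sym (∑-vanish r (λ _ → refl))
    ⟪⟫-∑ ((p , cₚ) ∷ L) r h = begin
      cₚ * ∑ F r (λ i → h i p) + ⟪ L ∣ (λ p → ∑ F r (λ i → h i p)) ⟫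
        ≈⟨ +-cong (sym (∑-*ˡ r cₚ (λ i → h i p))) (⟪⟫-∑ L r h) ⟩
      ∑ F r (λ i → cₚ * h i p) + ∑ F r (λ i → ⟪ L ∣ h i ⟫)
        ≈⟨ ∑-+ r _ _ ⟨
      ∑ F r (λ i → ⟪ (p , cₚ) ∷ L ∣ h i ⟫) ∎

    ⟪⟫-head : ∀ (s : A) (L : List (A × Carrier)) (f : A → Carrier) →
              All (λ e → f (proj₁ e) ≈ 0#) L → ⟪ (s , 1#) ∷ L ∣ f ⟫ ≈ f s
    ⟪⟫-head s L f f≈0 = trans (+-cong (*-identityˡ (f s)) (⟪⟫-vanish L f≈0)) (+-identityʳ (f s))

    ⟪⟫-annihilates : ∀ (L : List (A × Carrier)) r (α : Fin r → A → Carrier) (g : Fin r → Carrier) →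
                     (∀ i → ⟪ L ∣ α i ⟫ ≈ 0#) → ⟪ L ∣ (λ p → ∑ F r (λ i → α i p * g i)) ⟫ ≈ 0#
    ⟪⟫-annihilates L r α g L⊥α = begin
      ⟪ L ∣ (λ p → ∑ F r (λ i → α i p * g i)) ⟫ ≈⟨ ⟪⟫-∑ L r _ ⟩
      ∑ F r (λ i → ⟪ L ∣ (λ p → α i p * g i) ⟫) ≈⟨ ∑-vanish r vanish ⟩
      0#                                         ∎
      where
      vanish : ∀ i → ⟪ L ∣ (λ p → α i p * g i) ⟫ ≈ 0#
      vanish i = trans (⟪⟫-*ʳ L (g i) (α i)) (trans (*-congʳ (L⊥α i)) (zeroˡ (g i)))

    ⟪⟫-pull : ∀ (L : List (A × Carrier)) r (g : Fin r → Carrier) (h : Fin r → A → Carrier) →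
              ⟪ L ∣ (λ p → ∑ F r (λ i → g i * h i p)) ⟫ ≈ ∑ F r (λ i → g i * ⟪ L ∣ h i ⟫)
    ⟪⟫-pull L r g h = trans (⟪⟫-∑ L r _) (∑-cong r (λ i → ⟪⟫-*ˡ L (g i) (h i)))

¬¬-decideAll : ∀ {ℓ} n (P : Fin n → Set ℓ) → DoubleNegation (∀ x → Dec (P x))
¬¬-decideAll zero    P k = k (λ ())
¬¬-decideAll (suc n) P k =
  ¬¬-excluded-middle λ P₀? → ¬¬-decideAll n (P ∘ suc) λ P₊? →
    k λ { zero → P₀? ; (suc x) → P₊? x }

Weak : ∀ {k ℓ₁ ℓ₂} (K : StrictTotalOrder k ℓ₁ ℓ₂) → Rel (StrictTotalOrder.Carrier K) (ℓ₁ ⊔ˡ ℓ₂)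
Weak K = StrictToNonStrict._≤_ (StrictTotalOrder._≈_ K) (StrictTotalOrder._<_ K)

weak-refl : ∀ {k ℓ₁ ℓ₂} (K : StrictTotalOrder k ℓ₁ ℓ₂) {a} → Weak K a a
weak-refl K = inj₂ (StrictTotalOrder.Eq.refl K)

-- Linear algebra over a field relative to a total preorder on points, given by a labelling
-- of Fin m into a strict total order: Gaussian elimination with label-minimal pivots.
module Elimination {c ℓ} (F : CommutativeRing c ℓ) (isField : IsField F)
                   {k ℓ₁ ℓ₂} (K : StrictTotalOrder k ℓ₁ ℓ₂) where
  open CommutativeRing F hiding (zero)
  open Combinations F
  open StrictTotalOrder K using (compare; irrefl; <-respˡ-≈)
    renaming (Carrier to Label; _<_ to _⊏_; _≈_ to _≃_; trans to ⊏-trans; module Eq to ≃)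
  open import Algebra.Properties.Group +-group using (//-rightDividesˡ)
  open import Algebra.Properties.Ring ring using (-‿distribˡ-*)
  open import Algebra.Properties.CommutativeSemigroup +-commutativeSemigroup using (x∙yz≈y∙xz)
  open import Relation.Binary.Reasoning.Setoid setoid

  _⊑_ : Rel Label (ℓ₁ ⊔ˡ ℓ₂)
  _⊑_ = Weak K

  ⊑-⊏-trans : ∀ {a b c} → a ⊑ b → b ⊏ c → a ⊏ c
  ⊑-⊏-trans = StrictToNonStrict.≤-<-trans _≃_ _⊏_ ≃.sym ⊏-trans <-respˡ-≈

  firstViolation : ∀ {ℓz n} (label : Fin n → Label) (Z : Fin n → Set ℓz) → (∀ x → Dec (Z x)) →
    (∀ x → Z x) ⊎ Σ (Fin n) (λ p → ¬ Z p × (∀ x → label x ⊏ label p → Z x))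
  firstViolation {n = zero}  label Z Z? = inj₁ (λ ())
  firstViolation {n = suc n} label Z Z?
    with firstViolation (label ∘ suc) (Z ∘ suc) (Z? ∘ suc) | Z? zero
  ... | inj₁ Z₊ | yes Z₀ = inj₁ λ { zero → Z₀ ; (suc x) → Z₊ x }
  ... | inj₁ Z₊ | no ¬Z₀ =
    inj₂ (zero , ¬Z₀ , λ { zero l⊏l → ⊥-elim (irrefl ≃.refl l⊏l) ; (suc x) _ → Z₊ x })
  ... | inj₂ (p , ¬Zp , minp) | yes Z₀ =
    inj₂ (suc p , ¬Zp , λ { zero _ → Z₀ ; (suc x) x⊏p → minp x x⊏p })
  ... | inj₂ (p , ¬Zp , minp) | no ¬Z₀ with compare (label zero) (label (suc p))
  ...   | tri< l₀⊏lp _ _ =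
    inj₂ (zero , ¬Z₀ , λ { zero l⊏l → ⊥-elim (irrefl ≃.refl l⊏l)
                         ; (suc x) x⊏l₀ → minp x (⊏-trans x⊏l₀ l₀⊏lp) })
  ...   | tri≈ _ l₀≃lp _ =
    inj₂ (suc p , ¬Zp , λ { zero l₀⊏lp → ⊥-elim (irrefl l₀≃lp l₀⊏lp)
                          ; (suc x) x⊏p → minp x x⊏p })
  ...   | tri> _ _ lp⊏l₀ =
    inj₂ (suc p , ¬Zp , λ { zero l₀⊏lp → ⊥-elim (irrefl ≃.refl (⊏-trans l₀⊏lp lp⊏l₀))
                          ; (suc x) x⊏p → minp x x⊏p })

  module _ {m : ℕ} (label : Fin m → Label) where

    Below : Fin m → Fin m → Set (ℓ₁ ⊔ˡ ℓ₂)
    Below s p = p ≢ s × label p ⊑ label s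

    -- e_s + L is unit-triangular at s when every point of L lies below s.
    Triangular : Fin m → List (Fin m × Carrier) → Set (c ⊔ˡ ℓ₁ ⊔ˡ ℓ₂)
    Triangular s L = All (Below s ∘ proj₁) L

    unit-below : ∀ {s L} → Triangular s L → All (λ e → label (proj₁ e) ⊑ label s) ((s , 1#) ∷ L)
    unit-below tri = weak-refl K ∷ All.map proj₂ tri

    KernelVector : ∀ {r} → (Fin r → Fin m → Carrier) → Fin m → Set (c ⊔ˡ ℓ ⊔ˡ ℓ₁ ⊔ˡ ℓ₂)
    KernelVector α s = Σ (List (Fin m × Carrier)) λ L →
                         Triangular s L × (∀ i → ⟪ (s , 1#) ∷ L ∣ α i ⟫ ≈ 0#)

    record TriangularKernel r (α : Fin r → Fin m → Carrier) : Set (c ⊔ˡ ℓ ⊔ˡ ℓ₁ ⊔ˡ ℓ₂) where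
      field
        pivots     : List (Fin m)
        few-pivots : length pivots ℕ.≤ r
        kernel     : ∀ s → s ∉ pivots → KernelVector α s

    open TriangularKernel

    skipZero : ∀ {r} (α : Fin (suc r) → Fin m → Carrier) → (∀ x → α zero x ≈ 0#) →
               TriangularKernel r (α ∘ suc) → TriangularKernel (suc r) α
    skipZero α α₀≈0 ker = record
      { pivots     = pivots ker
      ; few-pivots = ℕ.m≤n⇒m≤1+n (few-pivots ker)
      ; kernel     = λ s s∉ → let (L , tri , L⊥α) = kernel ker s s∉ in
          L , tri , λ { zero → ⟪⟫-zero ((s , 1#) ∷ L) α₀≈0
                      ; (suc i) → L⊥α i }
      }

    module Pivot {r} (α : Fin (suc r) → Fin m → Carrier) (p : Fin m) (α₀p≉0 : ¬ α zero p ≈ 0#) where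
      α₀ : Fin m → Carrier
      α₀ = α zero

      inv : Carrier
      inv = proj₁ (proj₂ isField (α₀ p) α₀p≉0)

      cancel : ∀ t → t * inv * α₀ p ≈ t
      cancel t = begin
        t * inv * α₀ p   ≈⟨ *-assoc t inv (α₀ p) ⟩
        t * (inv * α₀ p) ≈⟨ *-congˡ (trans (*-comm inv (α₀ p)) (proj₂ (proj₂ isField (α₀ p) α₀p≉0))) ⟩
        t * 1#           ≈⟨ *-identityʳ t ⟩
        t                ∎

      coeff : Fin r → Carrier
      coeff i = α (suc i) p * inv

      reduced : Fin r → Fin m → Carrier
      reduced i x = α (suc i) x - coeff i * α₀ x

      reduced-p : ∀ i → reduced i p ≈ 0#
      reduced-p i = trans (+-congˡ (-‿cong (cancel (α (suc i) p)))) (-‿inverseʳ _)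

      recombine : ∀ L → ⟪ L ∣ α₀ ⟫ ≈ 0# → (∀ i → ⟪ L ∣ reduced i ⟫ ≈ 0#) → ∀ i → ⟪ L ∣ α i ⟫ ≈ 0#
      recombine L L⊥α₀ L⊥red zero    = L⊥α₀
      recombine L L⊥α₀ L⊥red (suc i) = begin
        ⟪ L ∣ α (suc i) ⟫
          ≈⟨ ⟪⟫-cong L (λ x → //-rightDividesˡ (coeff i * α₀ x) (α (suc i) x)) ⟨
        ⟪ L ∣ (λ x → reduced i x + coeff i * α₀ x) ⟫
          ≈⟨ ⟪⟫-+ L _ _ ⟩
        ⟪ L ∣ reduced i ⟫ + ⟪ L ∣ (λ x → coeff i * α₀ x) ⟫
          ≈⟨ +-cong (L⊥red i) (⟪⟫-*ˡ L (coeff i) α₀) ⟩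
        0# + coeff i * ⟪ L ∣ α₀ ⟫
          ≈⟨ +-identityˡ _ ⟩
        coeff i * ⟪ L ∣ α₀ ⟫
          ≈⟨ *-congˡ L⊥α₀ ⟩
        coeff i * 0#
          ≈⟨ zeroʳ _ ⟩
        0# ∎

      -- When p ⊑ s, adding the multiple of e_p cancelling ⟪ e_s + L ∣ α₀ ⟫ keeps e_s + L
      -- triangular and, since every reduced functional vanishes at p, in their kernel.
      addPivot : ∀ s → p ≢ s → label p ⊑ label s → KernelVector reduced s → KernelVector α s
      addPivot s p≢s p⊑s (L , tri , L⊥red) = (p , d) ∷ L , (p≢s , p⊑s) ∷ tri , recombine L′ L′⊥α₀ L′⊥red
        where
        σ d : Carrier
        σ = ⟪ (s , 1#) ∷ L ∣ α₀ ⟫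
        d = - (σ * inv)
        L′ : List (Fin m × Carrier)
        L′ = (s , 1#) ∷ (p , d) ∷ L
        expand : ∀ f → ⟪ L′ ∣ f ⟫ ≈ d * f p + ⟪ (s , 1#) ∷ L ∣ f ⟫
        expand f = x∙yz≈y∙xz _ _ _
        L′⊥α₀ : ⟪ L′ ∣ α₀ ⟫ ≈ 0#
        L′⊥α₀ = begin
          ⟪ L′ ∣ α₀ ⟫            ≈⟨ expand α₀ ⟩
          - (σ * inv) * α₀ p + σ ≈⟨ +-congʳ (-‿distribˡ-* (σ * inv) (α₀ p)) ⟨
          - (σ * inv * α₀ p) + σ ≈⟨ +-congʳ (-‿cong (cancel σ)) ⟩
          - σ + σ                ≈⟨ -‿inverseˡ σ ⟩
          0#                     ∎
        L′⊥red : ∀ i → ⟪ L′ ∣ reduced i ⟫ ≈ 0#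
        L′⊥red i = begin
          ⟪ L′ ∣ reduced i ⟫                          ≈⟨ expand (reduced i) ⟩
          d * reduced i p + ⟪ (s , 1#) ∷ L ∣ reduced i ⟫ ≈⟨ +-cong (*-congˡ (reduced-p i)) (L⊥red i) ⟩
          d * 0# + 0#                                  ≈⟨ +-identityʳ _ ⟩
          d * 0#                                       ≈⟨ zeroʳ d ⟩
          0#                                           ∎

      -- Lift a kernel vector of the reduced functionals at s ≠ p to one of α. If s precedes
      -- p then α₀, vanishing before p, already vanishes on e_s + L; otherwise use addPivot.
      lift : (∀ x → label x ⊏ label p → α₀ x ≈ 0#) → ∀ s → p ≢ s →
             KernelVector reduced s → KernelVector α s
      lift before s p≢s v with compare (label s) (label p)
      ... | tri< s⊏p _ _ = let (L , tri , L⊥red) = v in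
        L , tri , recombine ((s , 1#) ∷ L) (⟪⟫-vanish ((s , 1#) ∷ L)
          (before s s⊏p ∷ All.map (λ (_ , q⊑s) → before _ (⊑-⊏-trans q⊑s s⊏p)) tri)) L⊥red
      ... | tri≈ _ s≃p _ = addPivot s p≢s (inj₂ (≃.sym s≃p)) v
      ... | tri> _ _ p⊏s = addPivot s p≢s (inj₁ p⊏s) v

      eliminate : (∀ x → label x ⊏ label p → α₀ x ≈ 0#) →
                  TriangularKernel r reduced → TriangularKernel (suc r) α
      eliminate before ker = record
        { pivots     = p ∷ pivots ker
        ; few-pivots = s≤s (few-pivots ker)
        ; kernel     = λ s s∉ → lift before s (λ p≡s → s∉ (here (≡.sym p≡s))) (kernel ker s (s∉ ∘ there))
        }

    -- Every family of r functionals admits a triangular kernel with at most r pivots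
    -- (up to double negation, since equality in the field need not be decidable).
    triangularKernel : ∀ r (α : Fin r → Fin m → Carrier) → DoubleNegation (TriangularKernel r α)
    triangularKernel zero α k =
      k (record { pivots = [] ; few-pivots = z≤n ; kernel = λ s _ → [] , [] , λ () })
    triangularKernel (suc r) α k =
      ¬¬-decideAll m (λ x → α zero x ≈ 0#) λ zero? →
        [ (λ α₀≈0 → triangularKernel r (α ∘ suc) (k ∘ skipZero α α₀≈0))
        , (λ (p , α₀p≉0 , before) → let open Pivot α p α₀p≉0 in
             triangularKernel r reduced (k ∘ eliminate before))
        ] (firstViolation label (λ x → α zero x ≈ 0#) zero?)

missing : ∀ {m} (L : List (Fin m)) → length L ℕ.< m → Σ (Fin m) (_∉ L)
missing {m} L |L|<m with Fin.all? (λ s → any? (s ≟_) L)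
... | no ¬all = Fin.¬∀⟶∃¬ m _ (λ s → any? (s ≟_) L) ¬all
... | yes all with Fin.pigeonhole |L|<m (λ s → index (all s))
...   | i , j , i<j , same-index = ⊥-elim (Fin.<⇒≢ i<j (begin
        i                        ≡⟨ lookup-index (all i) ⟩
        lookup L (index (all i)) ≡⟨ ≡.cong (lookup L) same-index ⟩
        lookup L (index (all j)) ≡⟨ lookup-index (all j) ⟨
        j                        ∎))
  where open ≡.≡-Reasoning

length-++³ : ∀ {A : Set} (P Q R : List A) {r₁ r₂ r₃} →
             length P ℕ.≤ r₁ → length Q ℕ.≤ r₂ → length R ℕ.≤ r₃ →
             length (P ++ Q ++ R) ℕ.≤ r₁ ℕ.+ r₂ ℕ.+ r₃
length-++³ P Q R {r₁} {r₂} {r₃} |P|≤ |Q|≤ |R|≤ = begin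
  length (P ++ Q ++ R)                      ≡⟨ List.length-++ P ⟩
  length P ℕ.+ length (Q ++ R)              ≡⟨ ≡.cong (length P ℕ.+_) (List.length-++ Q) ⟩
  length P ℕ.+ (length Q ℕ.+ length R)      ≤⟨ ℕ.+-mono-≤ |P|≤ (ℕ.+-mono-≤ |Q|≤ |R|≤) ⟩
  r₁ ℕ.+ (r₂ ℕ.+ r₃)                        ≡⟨ ℕ.+-assoc r₁ r₂ r₃ ⟨
  r₁ ℕ.+ r₂ ℕ.+ r₃                          ∎
  where open ℕ.≤-Reasoning

module Contraction {c ℓ} (F : CommutativeRing c ℓ) where
  open CommutativeRing F hiding (zero)
  open Combinations F
  open import Relation.Binary.Reasoning.Setoid setoid

  contract : ∀ {X Y Z : Set} → List (X × Carrier) → List (Y × Carrier) → List (Z × Carrier) →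
             Tensor F X Y Z → Carrier
  contract u v w T = ⟪ w ∣ (λ z → ⟪ v ∣ (λ y → ⟪ u ∣ (λ x → T x y z) ⟫) ⟫) ⟫

  module _ {X Y Z : Set} (u : List (X × Carrier)) (v : List (Y × Carrier)) (w : List (Z × Carrier)) where

    contract-cong : ∀ {T T′ : Tensor F X Y Z} → (∀ x y z → T x y z ≈ T′ x y z) →
                    contract u v w T ≈ contract u v w T′
    contract-cong T≈T′ = ⟪⟫-cong w (λ z → ⟪⟫-cong v (λ y → ⟪⟫-cong u (λ x → T≈T′ x y z)))

    contract-+ : ∀ (T₁ T₂ : Tensor F X Y Z) →
                 contract u v w (λ x y z → T₁ x y z + T₂ x y z) ≈ contract u v w T₁ + contract u v w T₂
    contract-+ T₁ T₂ = begin
      contract u v w (λ x y z → T₁ x y z + T₂ x y z)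
        ≈⟨ ⟪⟫-cong w (λ z → ⟪⟫-cong v (λ y → ⟪⟫-+ u _ _)) ⟩
      ⟪ w ∣ (λ z → ⟪ v ∣ (λ y → ⟪ u ∣ (λ x → T₁ x y z) ⟫ + ⟪ u ∣ (λ x → T₂ x y z) ⟫) ⟫) ⟫
        ≈⟨ ⟪⟫-cong w (λ z → ⟪⟫-+ v _ _) ⟩
      ⟪ w ∣ (λ z → ⟪ v ∣ (λ y → ⟪ u ∣ (λ x → T₁ x y z) ⟫) ⟫ + ⟪ v ∣ (λ y → ⟪ u ∣ (λ x → T₂ x y z) ⟫) ⟫) ⟫
        ≈⟨ ⟪⟫-+ w _ _ ⟩
      contract u v w T₁ + contract u v w T₂ ∎

    contract-xSlices : ∀ r (α : Fin r → X → Carrier) (β : Fin r → Y → Z → Carrier) →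
                       (∀ i → ⟪ u ∣ α i ⟫ ≈ 0#) →
                       contract u v w (λ x y z → ∑ F r (λ i → α i x * β i y z)) ≈ 0#
    contract-xSlices r α β u⊥α =
      ⟪⟫-zero w (λ z → ⟪⟫-zero v (λ y → ⟪⟫-annihilates u r α (λ i → β i y z) u⊥α))

    contract-ySlices : ∀ r (α : Fin r → Y → Carrier) (β : Fin r → X → Z → Carrier) →
                       (∀ i → ⟪ v ∣ α i ⟫ ≈ 0#) →
                       contract u v w (λ x y z → ∑ F r (λ i → α i y * β i x z)) ≈ 0#
    contract-ySlices r α β v⊥α = ⟪⟫-zero w λ z → begin
      ⟪ v ∣ (λ y → ⟪ u ∣ (λ x → ∑ F r (λ i → α i y * β i x z)) ⟫) ⟫
        ≈⟨ ⟪⟫-cong v (λ y → ⟪⟫-pull u r (λ i → α i y) (λ i x → β i x z)) ⟩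
      ⟪ v ∣ (λ y → ∑ F r (λ i → α i y * ⟪ u ∣ (λ x → β i x z) ⟫)) ⟫
        ≈⟨ ⟪⟫-annihilates v r α _ v⊥α ⟩
      0# ∎

    contract-zSlices : ∀ r (α : Fin r → Z → Carrier) (β : Fin r → X → Y → Carrier) →
                       (∀ i → ⟪ w ∣ α i ⟫ ≈ 0#) →
                       contract u v w (λ x y z → ∑ F r (λ i → α i z * β i x y)) ≈ 0#
    contract-zSlices r α β w⊥α = begin
      ⟪ w ∣ (λ z → ⟪ v ∣ (λ y → ⟪ u ∣ (λ x → ∑ F r (λ i → α i z * β i x y)) ⟫) ⟫) ⟫
        ≈⟨ ⟪⟫-cong w (λ z → ⟪⟫-cong v (λ y → ⟪⟫-pull u r (λ i → α i z) (λ i x → β i x y))) ⟩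
      ⟪ w ∣ (λ z → ⟪ v ∣ (λ y → ∑ F r (λ i → α i z * ⟪ u ∣ (λ x → β i x y) ⟫)) ⟫) ⟫
        ≈⟨ ⟪⟫-cong w (λ z → ⟪⟫-pull v r (λ i → α i z) _) ⟩
      ⟪ w ∣ (λ z → ∑ F r (λ i → α i z * ⟪ v ∣ (λ y → ⟪ u ∣ (λ x → β i x y) ⟫) ⟫)) ⟫
        ≈⟨ ⟪⟫-annihilates w r α _ w⊥α ⟩
      0# ∎

    contract-decomposition : ∀ {T : Tensor F X Y Z} {r} (D : HasSliceRankDecomp F T r) →
      let open SliceDecomp (proj₁ D) in
      (∀ i → ⟪ u ∣ αx i ⟫ ≈ 0#) → (∀ i → ⟪ v ∣ αy i ⟫ ≈ 0#) → (∀ i → ⟪ w ∣ αz i ⟫ ≈ 0#) →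
      contract u v w T ≈ 0#
    contract-decomposition {T} (d , valid) u⊥αx v⊥αy w⊥αz = begin
      contract u v w T          ≈⟨ contract-cong valid ⟩
      contract u v w (λ x y z → (Sx x y z + Sy x y z) + Sz x y z)
        ≈⟨ contract-+ _ Sz ⟩
      contract u v w (λ x y z → Sx x y z + Sy x y z) + contract u v w Sz
        ≈⟨ +-congʳ (contract-+ Sx Sy) ⟩
      (contract u v w Sx + contract u v w Sy) + contract u v w Sz
        ≈⟨ +-cong (+-cong (contract-xSlices r₁ αx βx u⊥αx) (contract-ySlices r₂ αy βy v⊥αy))
                  (contract-zSlices r₃ αz βz w⊥αz) ⟩
      (0# + 0#) + 0#            ≈⟨ trans (+-identityʳ _) (+-identityʳ 0#) ⟩
      0#                        ∎
      where
      open SliceDecomp d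
      Sx Sy Sz : Tensor F X Y Z
      Sx x y z = ∑ F r₁ (λ i → αx i x * βx i y z)
      Sy x y z = ∑ F r₂ (λ i → αy i y * βy i x z)
      Sz x y z = ∑ F r₃ (λ i → αz i z * βz i x y)

module TriangularBound {c ℓ} (F : CommutativeRing c ℓ) (isField : IsField F)
  (Kx Ky Kz : StrictTotalOrder 0ℓ 0ℓ 0ℓ) {m : ℕ}
  (lx : Fin m → StrictTotalOrder.Carrier Kx)
  (ly : Fin m → StrictTotalOrder.Carrier Ky)
  (lz : Fin m → StrictTotalOrder.Carrier Kz)
  where
  open CommutativeRing F hiding (zero)
  open Combinations F
  open Contraction F
  module EX = Elimination F isField Kx
  module EY = Elimination F isField Ky
  module EZ = Elimination F isField Kz

  module _ (T : Tensor F (Fin m) (Fin m) (Fin m))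
    (triangular : ∀ s p q o → Weak Kx (lx p) (lx s) → Weak Ky (ly q) (ly s) → Weak Kz (lz o) (lz s) →
                  (p ≡ s × q ≡ s × o ≡ s) ⊎ T p q o ≈ 0#)
    (diagonal : ∀ s → T s s s ≈ 1#)
    where

    offDiagonal : ∀ {s p q o} → Weak Kx (lx p) (lx s) → Weak Ky (ly q) (ly s) → Weak Kz (lz o) (lz s) →
                  ¬ (p ≡ s × q ≡ s × o ≡ s) → T p q o ≈ 0#
    offDiagonal {s} {p} {q} {o} p⊑s q⊑s o⊑s not-s with triangular s p q o p⊑s q⊑s o⊑s
    ... | inj₁ all-s = ⊥-elim (not-s all-s)
    ... | inj₂ T≈0   = T≈0

    contract-triangular : ∀ s {Lx Ly Lz} → EX.Triangular lx s Lx → EY.Triangular ly s Ly →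
      EZ.Triangular lz s Lz → contract ((s , 1#) ∷ Lx) ((s , 1#) ∷ Ly) ((s , 1#) ∷ Lz) T ≈ T s s s
    contract-triangular s {Lx} {Ly} {Lz} tx ty tz =
      trans (⟪⟫-head s Lz H (All.map (λ (o≢s , o⊑s) → H-off o⊑s o≢s) tz)) H-diag
      where
      G : Fin m → Fin m → Carrier
      G q o = ⟪ (s , 1#) ∷ Lx ∣ (λ p → T p q o) ⟫
      G-off : ∀ {q o} → Weak Ky (ly q) (ly s) → Weak Kz (lz o) (lz s) → ¬ (q ≡ s × o ≡ s) → G q o ≈ 0#
      G-off q⊑s o⊑s not-s =
        ⟪⟫-vanish ((s , 1#) ∷ Lx) (All.map (λ p⊑s → offDiagonal p⊑s q⊑s o⊑s (not-s ∘ proj₂)) (EX.unit-below lx tx))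
      G-diag : G s s ≈ T s s s
      G-diag = ⟪⟫-head s Lx _
        (All.map (λ (p≢s , p⊑s) → offDiagonal p⊑s (weak-refl Ky) (weak-refl Kz) (p≢s ∘ proj₁)) tx)
      H : Fin m → Carrier
      H o = ⟪ (s , 1#) ∷ Ly ∣ (λ q → G q o) ⟫
      H-off : ∀ {o} → Weak Kz (lz o) (lz s) → o ≢ s → H o ≈ 0#
      H-off o⊑s o≢s = ⟪⟫-vanish ((s , 1#) ∷ Ly) (All.map (λ q⊑s → G-off q⊑s o⊑s (o≢s ∘ proj₂)) (EY.unit-below ly ty))
      H-diag : H s ≈ T s s s
      H-diag = trans (⟪⟫-head s Ly _ (All.map (λ (q≢s , q⊑s) → G-off q⊑s (weak-refl Kz) (q≢s ∘ proj₁)) ty))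
                     G-diag

    module _ {r} (D : HasSliceRankDecomp F T r) where
      open SliceDecomp (proj₁ D)

      noCommonKernel : ∀ s → EX.KernelVector lx αx s → EY.KernelVector ly αy s → EZ.KernelVector lz αz s → ⊥
      noCommonKernel s (Lx , tx , u⊥αx) (Ly , ty , v⊥αy) (Lz , tz , w⊥αz) = proj₁ isField (begin
        1#                       ≈⟨ diagonal s ⟨
        T s s s                  ≈⟨ contract-triangular s tx ty tz ⟨
        contract u v w T         ≈⟨ contract-decomposition u v w D u⊥αx v⊥αy w⊥αz ⟩
        0#                       ∎)
        where
        open import Relation.Binary.Reasoning.Setoid setoid
        u : List (Fin m × Carrier)
        u = (s , 1#) ∷ Lx
        v : List (Fin m × Carrier)
        v = (s , 1#) ∷ Ly
        w : List (Fin m × Carrier)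
        w = (s , 1#) ∷ Lz

      -- With r < m the three kernels have fewer than m pivots altogether.
      fewerThanM : r ℕ.< m → EX.TriangularKernel lx r₁ αx → EY.TriangularKernel ly r₂ αy →
                   EZ.TriangularKernel lz r₃ αz → ⊥
      fewerThanM r<m kx ky kz = noCommonKernel s
        (Kx.kernel s (s∉ ∘ ∈-++⁺ˡ))
        (Ky.kernel s (s∉ ∘ ∈-++⁺ʳ Kx.pivots ∘ ∈-++⁺ˡ))
        (Kz.kernel s (s∉ ∘ ∈-++⁺ʳ Kx.pivots ∘ ∈-++⁺ʳ Ky.pivots))
        where
        module Kx = EX.TriangularKernel kx
        module Ky = EY.TriangularKernel ky
        module Kz = EZ.TriangularKernel kz
        allPivots : List (Fin m)
        allPivots = Kx.pivots ++ Ky.pivots ++ Kz.pivots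
        nonPivot : Σ (Fin m) (_∉ allPivots)
        nonPivot = missing allPivots (ℕ.≤-<-trans
          (length-++³ Kx.pivots Ky.pivots Kz.pivots Kx.few-pivots Ky.few-pivots Kz.few-pivots)
          (≡.subst (ℕ._< m) (≡.sym total) r<m))
        s : Fin m
        s = proj₁ nonPivot
        s∉ : s ∉ allPivots
        s∉ = proj₂ nonPivot

    -- The core bound: the elimination lemma produces the three kernels (under ¬¬, harmless
    -- as the goal r ≥ m is decidable), and fewerThanM refutes r < m.
    lowerBound : ∀ r → HasSliceRankDecomp F T r → m ℕ.≤ r
    lowerBound r D = ℕ.≮⇒≥ λ r<m →
      EX.triangularKernel lx r₁ αx λ kx →
      EY.triangularKernel ly r₂ αy λ ky →
      EZ.triangularKernel lz r₃ αz λ kz →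
      fewerThanM D r<m kx ky kz
      where open SliceDecomp (proj₁ D)

module Tensors {c ℓ} (F : CommutativeRing c ℓ) where
  open CommutativeRing F hiding (zero)
  open Combinations F
  open import Relation.Binary.Reasoning.Setoid setoid

  δ-diag : ∀ {m} (i : Fin m) → δ F i i ≈ 1#
  δ-diag i = reflexive (≡.cong (if_then 1# else 0#) (dec-true (i ≟ i) ≡.refl))

  δ-off : ∀ {m} {i j : Fin m} → i ≢ j → δ F i j ≈ 0#
  δ-off {i = i} {j} i≢j = reflexive (≡.cong (if_then 1# else 0#) (dec-false (i ≟ j) i≢j))

  δ-sym : ∀ {m} (i j : Fin m) → δ F i j ≈ δ F j i
  δ-sym i j with i ≟ j
  ... | yes ≡.refl = sym (δ-diag i)
  ... | no i≢j     = sym (δ-off (i≢j ∘ ≡.sym))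

  ∑-δ : ∀ r (j : Fin r) (g : Fin r → Carrier) → ∑ F r (λ i → δ F j i * g i) ≈ g j
  ∑-δ (suc r) zero g = begin
    1# * g zero + ∑ F r (λ i → 0# * g (suc i)) ≈⟨ +-cong (*-identityˡ _) (∑-vanish r (λ i → zeroˡ _)) ⟩
    g zero + 0#                                 ≈⟨ +-identityʳ _ ⟩
    g zero                                      ∎
  ∑-δ (suc r) (suc j) g = begin
    0# * g zero + ∑ F r (λ i → δ F j i * g (suc i)) ≈⟨ +-cong (zeroˡ _) (∑-δ r j (g ∘ suc)) ⟩
    0# + g (suc j)                                  ≈⟨ +-identityˡ _ ⟩
    g (suc j)                                       ∎

  restrict : ∀ {X Y Z X′ Y′ Z′ : Set} {T : Tensor F X Y Z} {r}
             (φ : X′ → X) (ψ : Y′ → Y) (χ : Z′ → Z) →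
             HasSliceRankDecomp F T r → HasSliceRankDecomp F (λ x y z → T (φ x) (ψ y) (χ z)) r
  restrict {T = T} {r} φ ψ χ (d , valid) = d′ , λ x y z → valid (φ x) (ψ y) (χ z)
    where
    open SliceDecomp d
    d′ : SliceDecomp F (λ x y z → T (φ x) (ψ y) (χ z)) r
    d′ = record
      { r₁ = r₁ ; r₂ = r₂ ; r₃ = r₃ ; total = total
      ; αx = λ i x → αx i (φ x) ; βx = λ i y z → βx i (ψ y) (χ z)
      ; αy = λ i y → αy i (ψ y) ; βy = λ i x z → βy i (φ x) (χ z)
      ; αz = λ i z → αz i (χ z) ; βz = λ i x y → βz i (φ x) (ψ y) }

  rotate : ∀ {X Y Z : Set} {T : Tensor F X Y Z} {T′ : Tensor F Y Z X} {r} →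
           (∀ x y z → T′ y z x ≈ T x y z) →
           HasSliceRankDecomp F T r → HasSliceRankDecomp F T′ r
  rotate {T′ = T′} {r} T′≈T (d , valid) = d′ , λ y z x → trans (T′≈T x y z) (trans (valid x y z) (rotate-sum _ _ _))
    where
    open SliceDecomp d
    rotate-sum : ∀ a b c → (a + b) + c ≈ (b + c) + a
    rotate-sum a b c = trans (+-assoc a b c) (+-comm a (b + c))
    d′ : SliceDecomp F T′ r
    d′ = record
      { r₁ = r₂ ; r₂ = r₃ ; r₃ = r₁
      ; total = ≡.trans (ℕ.+-comm (r₂ ℕ.+ r₃) r₁) (≡.trans (≡.sym (ℕ.+-assoc r₁ r₂ r₃)) total)
      ; αx = αy ; βx = λ i z x → βy i x z
      ; αy = αz ; βy = λ i y x → βz i x y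
      ; αz = αx ; βz = λ i y z → βx i y z }

  xSliceDecomposition : ∀ {X Y Z : Set} (T : Tensor F X Y Z) r (e : Fin r → X) (d : X → Fin r) →
                        (∀ x → e (d x) ≡ x) → HasSliceRankDecomp F T r
  xSliceDecomposition T r e d e∘d≗id = slices , valid
    where
    slices : SliceDecomp F T r
    slices = record
      { r₁ = r ; r₂ = 0 ; r₃ = 0 ; total = ≡.trans (ℕ.+-identityʳ (r ℕ.+ 0)) (ℕ.+-identityʳ r)
      ; αx = λ i x → δ F (d x) i ; βx = λ i y z → T (e i) y z
      ; αy = λ () ; βy = λ () ; αz = λ () ; βz = λ () }
    valid : SliceDecompValid F T r slices
    valid x y z = begin
      T x y z                                     ≡⟨ ≡.cong (λ x′ → T x′ y z) (e∘d≗id x) ⟨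
      T (e (d x)) y z                             ≈⟨ ∑-δ r (d x) (λ i → T (e i) y z) ⟨
      ∑ F r (λ i → δ F (d x) i * T (e i) y z)     ≈⟨ +-identityʳ _ ⟨
      ∑ F r (λ i → δ F (d x) i * T (e i) y z) + 0# ≈⟨ +-identityʳ _ ⟨
      (∑ F r (λ i → δ F (d x) i * T (e i) y z) + 0#) + 0# ∎

  rotate-power : ∀ {X Y Z : Set} {T : Tensor F X Y Z} {T′ : Tensor F Y Z X} →
                 (∀ x y z → T′ y z x ≈ T x y z) →
                 ∀ n xs ys zs → tensorPow F T′ n ys zs xs ≈ tensorPow F T n xs ys zs
  rotate-power T′≈T zero    []       []       []       = refl
  rotate-power T′≈T (suc n) (x ∷ xs) (y ∷ ys) (z ∷ zs) = *-cong (T′≈T x y z) (rotate-power T′≈T n xs ys zs)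

map-injective : ∀ {A B : Set} {f : A → B} → Injective _≡_ _≡_ f →
                ∀ {n} → Injective _≡_ _≡_ (map {n = n} f)
map-injective f-inj {zero}  {[]}     {[]}     _  = ≡.refl
map-injective f-inj {suc n} {x ∷ xs} {y ∷ ys} eq =
  let (fx≡fy , fxs≡fys) = ∷-injective eq in
  ≡.cong₂ _∷_ (f-inj fx≡fy) (map-injective f-inj fxs≡fys)

lexOrder : StrictTotalOrder 0ℓ 0ℓ 0ℓ → ℕ → StrictTotalOrder 0ℓ 0ℓ 0ℓ
lexOrder = VecLex.<-strictTotalOrder

lex-head : ∀ (K : StrictTotalOrder 0ℓ 0ℓ 0ℓ) {n a b} {as bs : Vec _ n} →
           Weak (lexOrder K (suc n)) (a ∷ as) (b ∷ bs) → Weak K a b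
lex-head K (inj₁ (VecLex.this a<b _)) = inj₁ a<b
lex-head K (inj₁ (VecLex.next a≈b _)) = inj₂ a≈b
lex-head K (inj₂ (a≈b ∷ _))           = inj₂ a≈b

lex-tail : ∀ (K : StrictTotalOrder 0ℓ 0ℓ 0ℓ) {n a} {as bs : Vec _ n} →
           Weak (lexOrder K (suc n)) (a ∷ as) (a ∷ bs) → Weak (lexOrder K n) as bs
lex-tail K (inj₁ (VecLex.this a<a _))   = ⊥-elim (StrictTotalOrder.irrefl K (StrictTotalOrder.Eq.refl K) a<a)
lex-tail K (inj₁ (VecLex.next _ as<bs)) = inj₁ as<bs
lex-tail K (inj₂ (_ ∷ as≋bs))           = inj₂ as≋bs

module Triangulations {c ℓ} (F : CommutativeRing c ℓ) where
  open CommutativeRing F hiding (zero)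

  record Triangulation {X Y Z : Set} (T : Tensor F X Y Z) : Set (lsuc 0ℓ ⊔ˡ c ⊔ˡ ℓ) where
    field
      Kx Ky Kz    : StrictTotalOrder 0ℓ 0ℓ 0ℓ
      lx          : X → StrictTotalOrder.Carrier Kx
      ly          : Y → StrictTotalOrder.Carrier Ky
      lz          : Z → StrictTotalOrder.Carrier Kz
      ι           : X → Y
      κ           : X → Z
      ι-injective : Injective _≡_ _≡_ ι
      κ-injective : Injective _≡_ _≡_ κ
      diagonal    : ∀ x → T x (ι x) (κ x) ≈ 1#
      triangular  : ∀ x x′ y′ z′ →
        Weak Kx (lx x′) (lx x) → Weak Ky (ly y′) (ly (ι x)) → Weak Kz (lz z′) (lz (κ x)) →
        (x′ ≡ x × y′ ≡ ι x × z′ ≡ κ x) ⊎ T x′ y′ z′ ≈ 0#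

  power : ∀ {X Y Z : Set} {T : Tensor F X Y Z} → Triangulation T → ∀ n → Triangulation (tensorPow F T n)
  power {X} {Y} {Z} {T} Δ n = record
    { Kx = lexOrder Kx n ; Ky = lexOrder Ky n ; Kz = lexOrder Kz n
    ; lx = map lx ; ly = map ly ; lz = map lz
    ; ι = map ι ; κ = map κ
    ; ι-injective = map-injective ι-injective
    ; κ-injective = map-injective κ-injective
    ; diagonal = diagonal^ n
    ; triangular = triangular^ n
    }
    where
    open Triangulation Δ
    diagonal^ : ∀ n (xs : Vec X n) → tensorPow F T n xs (map ι xs) (map κ xs) ≈ 1#
    diagonal^ zero    []       = refl
    diagonal^ (suc n) (x ∷ xs) = trans (*-cong (diagonal x) (diagonal^ n xs)) (*-identityˡ 1#)

    triangular^ : ∀ n (xs xs′ : Vec X n) (ys′ : Vec Y n) (zs′ : Vec Z n) →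
      Weak (lexOrder Kx n) (map lx xs′) (map lx xs) →
      Weak (lexOrder Ky n) (map ly ys′) (map ly (map ι xs)) →
      Weak (lexOrder Kz n) (map lz zs′) (map lz (map κ xs)) →
      (xs′ ≡ xs × ys′ ≡ map ι xs × zs′ ≡ map κ xs) ⊎ tensorPow F T n xs′ ys′ zs′ ≈ 0#
    triangular^ zero [] [] [] [] _ _ _ = inj₁ (≡.refl , ≡.refl , ≡.refl)
    triangular^ (suc n) (x ∷ xs) (x′ ∷ xs′) (y′ ∷ ys′) (z′ ∷ zs′) xs′⊑ ys′⊑ zs′⊑
      with triangular x x′ y′ z′ (lex-head Kx xs′⊑) (lex-head Ky ys′⊑) (lex-head Kz zs′⊑)
    ... | inj₂ T≈0 = inj₂ (trans (*-congʳ T≈0) (zeroˡ _))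
    ... | inj₁ (≡.refl , ≡.refl , ≡.refl)
      with triangular^ n xs xs′ ys′ zs′ (lex-tail Kx xs′⊑) (lex-tail Ky ys′⊑) (lex-tail Kz zs′⊑)
    ...   | inj₁ (≡.refl , ≡.refl , ≡.refl) = inj₁ (≡.refl , ≡.refl , ≡.refl)
    ...   | inj₂ rest≈0                     = inj₂ (trans (*-congˡ rest≈0) (zeroʳ _))

  -- A triangulated tensor whose x-coordinates contain an injective image of Fin m has
  -- slice rank at least m: restrict to the m diagonal points and apply the core bound.
  triangulationBound : ∀ {X Y Z : Set} {T : Tensor F X Y Z} → Triangulation T →
    IsField F → ∀ {m} (e : Fin m → X) → Injective _≡_ _≡_ e →
    ∀ r → HasSliceRankDecomp F T r → m ℕ.≤ r
  triangulationBound {T = T} Δ isField e e-injective r D =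
    lowerBound (λ s t o → T (e s) (ι (e t)) (κ (e o))) triangular′ (diagonal ∘ e) r
               (Tensors.restrict F e (ι ∘ e) (κ ∘ e) D)
    where
    open Triangulation Δ
    open TriangularBound F isField Kx Ky Kz (lx ∘ e) (ly ∘ ι ∘ e) (lz ∘ κ ∘ e)
    triangular′ : ∀ s p q o → Weak Kx (lx (e p)) (lx (e s)) → Weak Ky (ly (ι (e q))) (ly (ι (e s))) →
                  Weak Kz (lz (κ (e o))) (lz (κ (e s))) →
                  (p ≡ s × q ≡ s × o ≡ s) ⊎ T (e p) (ι (e q)) (κ (e o)) ≈ 0#
    triangular′ s p q o p⊑s q⊑s o⊑s with triangular (e s) (e p) (ι (e q)) (κ (e o)) p⊑s q⊑s o⊑s
    ... | inj₁ (ep≡es , ιeq≡ιes , κeo≡κes) =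
      inj₁ (e-injective ep≡es , e-injective (ι-injective ιeq≡ιes) , e-injective (κ-injective κeo≡κes))
    ... | inj₂ T≈0 = inj₂ T≈0

module Arithmetic where
  open import Data.Nat using (_+_; _*_; _^_; _<_; _≤_; pred)
  open ≡.≡-Reasoning

  -- x ↦ (x + j) mod c is injective on x < c: adding j * pred c undoes the shift by j modulo c.
  +-mod-injective : ∀ {x x′} j c .{{_ : NonZero c}} → x < c → x′ < c →
                    (x + j) % c ≡ (x′ + j) % c → x ≡ x′
  +-mod-injective {x} {x′} j c x<c x′<c eq = begin
    x                                      ≡⟨ unshift x<c ⟩
    ((x + j) % c + (j * pred c) % c) % c   ≡⟨ ≡.cong (λ t → (t + (j * pred c) % c) % c) eq ⟩
    ((x′ + j) % c + (j * pred c) % c) % c  ≡⟨ unshift x′<c ⟨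
    x′                                     ∎
    where
    unshift : ∀ {y} → y < c → y ≡ ((y + j) % c + (j * pred c) % c) % c
    unshift {y} y<c = begin
      y                              ≡⟨ m<n⇒m%n≡m y<c ⟨
      y % c                          ≡⟨ [m+kn]%n≡m%n y j c ⟨
      (y + j * c) % c                ≡⟨ ≡.cong (λ t → (y + t) % c) j*c≡j+j*pred-c ⟩
      (y + (j + j * pred c)) % c     ≡⟨ ≡.cong (_% c) (ℕ.+-assoc y j (j * pred c)) ⟨
      (y + j + j * pred c) % c       ≡⟨ %-distribˡ-+ (y + j) (j * pred c) c ⟩
      ((y + j) % c + (j * pred c) % c) % c ∎
      where
      j*c≡j+j*pred-c : j * c ≡ j + j * pred c
      j*c≡j+j*pred-c = ≡.trans (≡.cong (j *_) (≡.sym (ℕ.suc-pred c))) (ℕ.*-suc j (pred c))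

  vecEnumeration : ∀ {k} {X : Set} → Fin k ↔ X → ∀ n → Fin (k ^ n) ↔ Vec X n
  vecEnumeration E zero    = mk↔ₛ′ (λ _ → []) (λ _ → zero) (λ { [] → ≡.refl }) (λ { zero → ≡.refl })
  vecEnumeration {k} {X} E (suc n) = mk↔ₛ′ to from to∘from from∘to
    where
    module E = Inverse E
    module R = Inverse (vecEnumeration E n)
    cons : Fin k × Fin (k ^ n) → Vec X (suc n)
    cons (p , q) = E.to p ∷ R.to q
    to : Fin (k ^ suc n) → Vec X (suc n)
    to = cons ∘ remQuot (k ^ n)
    from : Vec X (suc n) → Fin (k ^ suc n)
    from (x ∷ xs) = combine (E.from x) (R.from xs)
    to∘from : ∀ xs → to (from xs) ≡ xs
    to∘from (x ∷ xs) = begin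
      cons (remQuot (k ^ n) (combine (E.from x) (R.from xs))) ≡⟨ ≡.cong cons (Fin.remQuot-combine (E.from x) _) ⟩
      E.to (E.from x) ∷ R.to (R.from xs)                      ≡⟨ ≡.cong₂ _∷_ (E.strictlyInverseˡ x) (R.strictlyInverseˡ xs) ⟩
      x ∷ xs                                                  ∎
    from∘to : ∀ t → from (to t) ≡ t
    from∘to t = begin
      combine (E.from (E.to p)) (R.from (R.to q)) ≡⟨ ≡.cong₂ combine (E.strictlyInverseʳ p) (R.strictlyInverseʳ q) ⟩
      combine p q                                 ≡⟨ Fin.combine-remQuot {k} (k ^ n) t ⟩
      t                                           ∎
      where
      p : Fin k
      p = proj₁ (remQuot {k} (k ^ n) t)
      q : Fin (k ^ n)
      q = proj₂ (remQuot {k} (k ^ n) t)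

  lexSandwich : ∀ {i j k i′ j′ k′} →
    i′ < i ⊎ (i′ ≡ i × j′ ≤ j) → k′ < k ⊎ (k′ ≡ k × j ≤ j′) → i + k ≤ i′ + k′ →
    i′ ≡ i × j′ ≡ j × k′ ≡ k
  lexSandwich (inj₁ i′<i) k′⊑k sum≤ = ⊥-elim (ℕ.<⇒≱ (ℕ.+-mono-<-≤ i′<i (k′≤k k′⊑k)) sum≤)
    where
    k′≤k : ∀ {k k′ j j′} → k′ < k ⊎ (k′ ≡ k × j ≤ j′) → k′ ≤ k
    k′≤k (inj₁ k′<k)       = ℕ.<⇒≤ k′<k
    k′≤k (inj₂ (k′≡k , _)) = ℕ.≤-reflexive k′≡k
  lexSandwich {i} (inj₂ (≡.refl , _)) (inj₁ k′<k) sum≤ = ⊥-elim (ℕ.<⇒≱ (ℕ.+-monoʳ-< i k′<k) sum≤)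
  lexSandwich (inj₂ (≡.refl , j′≤j)) (inj₂ (≡.refl , j≤j′)) _ = ≡.refl , ℕ.≤-antisym j′≤j j≤j′ , ≡.refl

open Arithmetic

module MatrixMultiplication {ℓ₁ ℓ₂} (F : CommutativeRing ℓ₁ ℓ₂) where
  open CommutativeRing F hiding (zero)
  open Tensors F
  open Triangulations F

  mm-support : ∀ {a b c} i′ j′ j k k″ i″ →
    (j′ ≡ j × k ≡ k″ × i′ ≡ i″) ⊎ MM F a b c (i′ , j′) (j , k) (k″ , i″) ≈ 0#
  mm-support i′ j′ j k k″ i″ with j′ ≟ j | k ≟ k″ | i′ ≟ i″
  ... | yes j≡ | yes k≡ | yes i≡ = inj₁ (j≡ , k≡ , i≡)
  ... | no _   | _      | _      = inj₂ (trans (*-congʳ (zeroˡ _)) (zeroˡ _))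
  ... | yes _  | no _   | _      = inj₂ (trans (*-congʳ (zeroʳ _)) (zeroˡ _))
  ... | yes _  | yes _  | no _   = inj₂ (zeroʳ _)

  mm-rotation : ∀ a b c x y z → MM F b c a y z x ≈ MM F a b c x y z
  mm-rotation a b c (i′ , j′) (j , k) (k″ , i) = begin
    (δ F k k″ * δ F i i′) * δ F j j′   ≈⟨ *-cong (*-congˡ (δ-sym i i′)) (δ-sym j j′) ⟩
    (δ F k k″ * δ F i′ i) * δ F j′ j   ≈⟨ *-comm _ _ ⟩
    δ F j′ j * (δ F k k″ * δ F i′ i)   ≈⟨ *-assoc _ _ _ ⟨
    (δ F j′ j * δ F k k″) * δ F i′ i   ∎
    where open import Relation.Binary.Reasoning.Setoid setoid

  module _ (a b c : ℕ) .{{_ : NonZero c}} (a≤c : a ℕ.≤ c) (b≤c : b ℕ.≤ c) where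

    third : Fin a → Fin b → Fin c
    third i j = (toℕ i ℕ.+ toℕ j) mod c

    toℕ-third : ∀ i j → toℕ (third i j) ≡ (toℕ i ℕ.+ toℕ j) % c
    toℕ-third i j = Fin.toℕ-fromℕ< (m%n<n (toℕ i ℕ.+ toℕ j) c)

    third-injectiveˡ : ∀ {i i′} j → third i j ≡ third i′ j → i ≡ i′
    third-injectiveˡ {i} {i′} j eq = Fin.toℕ-injective (+-mod-injective (toℕ j) c
      (ℕ.<-≤-trans (Fin.toℕ<n i) a≤c) (ℕ.<-≤-trans (Fin.toℕ<n i′) a≤c)
      (≡.trans (≡.sym (toℕ-third i j)) (≡.trans (≡.cong toℕ eq) (toℕ-third i′ j))))

    third-injectiveʳ : ∀ i {j j′} → third i j ≡ third i j′ → j ≡ j′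
    third-injectiveʳ i {j} {j′} eq = Fin.toℕ-injective (+-mod-injective (toℕ i) c
      (ℕ.<-≤-trans (Fin.toℕ<n j) b≤c) (ℕ.<-≤-trans (Fin.toℕ<n j′) b≤c)
      (≡.trans (≡.cong (_% c) (ℕ.+-comm (toℕ j) (toℕ i)))
        (≡.trans (≡.sym (toℕ-third i j)) (≡.trans (≡.cong toℕ eq)
          (≡.trans (toℕ-third i j′) (≡.cong (_% c) (ℕ.+-comm (toℕ i) (toℕ j′))))))))

    ι : Fin a × Fin b → Fin b × Fin c
    ι (i , j) = j , third i j

    κ : Fin a × Fin b → Fin c × Fin a
    κ (i , j) = third i j , i

    -- Orders: x_{ij} by (i, j), y_{jk} by (k, -j), z_{ki} by -(i + k), all lexicographic.
    Kx Ky Kz : StrictTotalOrder 0ℓ 0ℓ 0ℓ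
    Kx = ×-strictTotalOrder (Fin.<-strictTotalOrder a) (Fin.<-strictTotalOrder b)
    Ky = ×-strictTotalOrder (Fin.<-strictTotalOrder c) (Flip.strictTotalOrder (Fin.<-strictTotalOrder b))
    Kz = Flip.strictTotalOrder ℕ.<-strictTotalOrder

    ly : Fin b × Fin c → Fin c × Fin b
    ly (j , k) = k , j

    lz : Fin c × Fin a → ℕ
    lz (k , i) = toℕ i ℕ.+ toℕ k

    weakX : ∀ {i i′ j j′} → Weak Kx (i′ , j′) (i , j) →
            toℕ i′ ℕ.< toℕ i ⊎ (toℕ i′ ≡ toℕ i × toℕ j′ ℕ.≤ toℕ j)
    weakX (inj₁ (inj₁ i′<i))          = inj₁ i′<i
    weakX (inj₁ (inj₂ (i′≡i , j′<j))) = inj₂ (≡.cong toℕ i′≡i , ℕ.<⇒≤ j′<j)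
    weakX (inj₂ (i′≡i , j′≡j))        = inj₂ (≡.cong toℕ i′≡i , ℕ.≤-reflexive (≡.cong toℕ j′≡j))

    weakY : ∀ {j j′ k k′} → Weak Ky (k′ , j′) (k , j) →
            toℕ k′ ℕ.< toℕ k ⊎ (toℕ k′ ≡ toℕ k × toℕ j ℕ.≤ toℕ j′)
    weakY (inj₁ (inj₁ k′<k))          = inj₁ k′<k
    weakY (inj₁ (inj₂ (k′≡k , j<j′))) = inj₂ (≡.cong toℕ k′≡k , ℕ.<⇒≤ j<j′)
    weakY (inj₂ (k′≡k , j′≡j))        = inj₂ (≡.cong toℕ k′≡k , ℕ.≤-reflexive (≡.cong toℕ (≡.sym j′≡j)))

    weakZ : ∀ {s s′} → Weak Kz s′ s → s ℕ.≤ s′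
    weakZ (inj₁ s<s′) = ℕ.<⇒≤ s<s′
    weakZ (inj₂ s′≡s) = ℕ.≤-reflexive (≡.sym s′≡s)

    mm-triangular : ∀ x x′ y′ z′ → Weak Kx x′ x → Weak Ky (ly y′) (ly (ι x)) → Weak Kz (lz z′) (lz (κ x)) →
                    (x′ ≡ x × y′ ≡ ι x × z′ ≡ κ x) ⊎ MM F a b c x′ y′ z′ ≈ 0#
    mm-triangular (i , j) (i′ , j′) (j″ , k′) (k″ , i″) x′⊑x y′⊑y z′⊑z
      with mm-support i′ j′ j″ k′ k″ i″
    ... | inj₂ MM≈0 = inj₂ MM≈0
    ... | inj₁ (≡.refl , ≡.refl , ≡.refl)
      with lexSandwich (weakX x′⊑x) (weakY y′⊑y) (weakZ z′⊑z)
    ... | i′≡i , j′≡j , k′≡k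
      with Fin.toℕ-injective i′≡i | Fin.toℕ-injective j′≡j | Fin.toℕ-injective k′≡k
    ... | ≡.refl | ≡.refl | ≡.refl = inj₁ (≡.refl , ≡.refl , ≡.refl)

    mm-triangulation : Triangulation (MM F a b c)
    mm-triangulation = record
      { Kx = Kx ; Ky = Ky ; Kz = Kz
      ; lx = λ x → x ; ly = ly ; lz = lz
      ; ι = ι ; κ = κ
      ; ι-injective = λ { {i , j} {i′ , j′} eq → ι-inj (≡.cong proj₁ eq) (≡.cong proj₂ eq) }
      ; κ-injective = λ { {i , j} {i′ , j′} eq → κ-inj (≡.cong proj₁ eq) (≡.cong proj₂ eq) }
      ; diagonal = λ (i , j) →
          trans (*-cong (trans (*-cong (δ-diag j) (δ-diag (third i j))) (*-identityˡ 1#)) (δ-diag i))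
                (*-identityˡ 1#)
      ; triangular = mm-triangular
      }
      where
      ι-inj : ∀ {i i′ j j′} → j ≡ j′ → third i j ≡ third i′ j′ → (i , j) ≡ (i′ , j′)
      ι-inj {j = j} ≡.refl eq = ≡.cong (_, j) (third-injectiveˡ j eq)
      κ-inj : ∀ {i i′ j j′} → third i j ≡ third i′ j′ → i ≡ i′ → (i , j) ≡ (i′ , j′)
      κ-inj {i} eq ≡.refl = ≡.cong (i ,_) (third-injectiveʳ i eq)

  ExactPowers : ℕ → ℕ → ℕ → ℕ → Set (ℓ₁ ⊔ˡ ℓ₂)
  ExactPowers a b c M =
    (∀ n → HasSliceRankDecomp F (tensorPow F (MM F a b c) n) (M ℕ.^ n)) ×
    (∀ n r → HasSliceRankDecomp F (tensorPow F (MM F a b c) n) r → M ℕ.^ n ℕ.≤ r)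

  mm-upper : ∀ a b c n → HasSliceRankDecomp F (tensorPow F (MM F a b c) n) ((a ℕ.* b) ℕ.^ n)
  mm-upper a b c n = xSliceDecomposition _ _ (Inverse.to E) (Inverse.from E) (Inverse.strictlyInverseˡ E)
    where E = vecEnumeration Fin.*↔× n

  exact-when-c-max : IsField F → ∀ a b c .{{_ : NonZero c}} → a ℕ.≤ c → b ℕ.≤ c → ExactPowers a b c (a ℕ.* b)
  exact-when-c-max isField a b c a≤c b≤c = mm-upper a b c , lower
    where
    lower : ∀ n r → HasSliceRankDecomp F (tensorPow F (MM F a b c) n) r → (a ℕ.* b) ℕ.^ n ℕ.≤ r
    lower n = triangulationBound (power (mm-triangulation a b c a≤c b≤c) n) isField
                (Inverse.to E) (Injection.injective (↔⇒↣ E))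
      where E = vecEnumeration Fin.*↔× n

  exact-rotate : ∀ {a b c M} → ExactPowers a b c M → ExactPowers b c a M
  exact-rotate {a} {b} {c} (upper , lower) =
    (λ n → rotate (rot a b c n) (upper n)) ,
    (λ n r → lower n r ∘ rotate (rot c a b n) ∘ rotate (rot b c a n))
    where
    rot : ∀ a b c n xs ys zs → tensorPow F (MM F b c a) n ys zs xs ≈ tensorPow F (MM F a b c) n xs ys zs
    rot a b c = rotate-power (mm-rotation a b c)

open import Data.Nat using (_*_; _^_; _≤_; _<_; _⊔_)
open import Algebra.Properties.CommutativeSemigroup ℕ.*-commutativeSemigroup
  using (interchange; xy∙z≈xz∙y; xy∙z≈zx∙y; xy∙z≈yz∙x)

-- The exponent of ⟨a,b,c⟩ is M = abc / max{a,b,c}: rotate the largest dimension to the end.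
exactPowers : ∀ {ℓ₁ ℓ₂} (F : CommutativeRing ℓ₁ ℓ₂) → IsField F →
  ∀ a b c → .{{NonZero a}} → .{{NonZero b}} → .{{NonZero c}} →
  Σ ℕ λ M → MatrixMultiplication.ExactPowers F a b c M × M * (a ⊔ b ⊔ c) ≡ a * b * c
exactPowers F isField a b c with ℕ.≤-total (a ⊔ b) c | ℕ.≤-total b a
... | inj₁ a⊔b≤c | _ =
  a * b , exact-when-c-max isField a b c (ℕ.m⊔n≤o⇒m≤o a b a⊔b≤c) (ℕ.m⊔n≤o⇒n≤o a b a⊔b≤c) ,
  ≡.cong (a * b *_) (ℕ.m≤n⇒m⊔n≡n a⊔b≤c)
  where open MatrixMultiplication F
... | inj₂ c≤a⊔b | inj₁ b≤a =
  b * c , exact-rotate (exact-rotate (exact-when-c-max isField b c a b≤a c≤a)) ,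
  ≡.trans (≡.cong (b * c *_) max≡a) (xy∙z≈zx∙y b c a)
  where
  open MatrixMultiplication F
  a⊔b≡a : a ⊔ b ≡ a
  a⊔b≡a = ℕ.m≥n⇒m⊔n≡m b≤a
  c≤a : c ≤ a
  c≤a = ≡.subst (c ≤_) a⊔b≡a c≤a⊔b
  max≡a : a ⊔ b ⊔ c ≡ a
  max≡a = ≡.trans (≡.cong (_⊔ c) a⊔b≡a) (ℕ.m≥n⇒m⊔n≡m c≤a)
... | inj₂ c≤a⊔b | inj₂ a≤b =
  c * a , exact-rotate (exact-when-c-max isField c a b c≤b a≤b) ,
  ≡.trans (≡.cong (c * a *_) max≡b) (xy∙z≈yz∙x c a b)
  where
  open MatrixMultiplication F
  a⊔b≡b : a ⊔ b ≡ b
  a⊔b≡b = ℕ.m≤n⇒m⊔n≡n a≤b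
  c≤b : c ≤ b
  c≤b = ≡.subst (c ≤_) a⊔b≡b c≤a⊔b
  max≡b : a ⊔ b ⊔ c ≡ b
  max≡b = ≡.trans (≡.cong (_⊔ c) a⊔b≡b) (ℕ.m≥n⇒m⊔n≡m c≤b)

^-distrib-* : ∀ x y n → (x * y) ^ n ≡ x ^ n * y ^ n
^-distrib-* x y zero    = ≡.refl
^-distrib-* x y (suc n) = ≡.trans (≡.cong ((x * y) *_) (^-distrib-* x y n)) (interchange x y (x ^ n) (y ^ n))

upperRate : ∀ {M d k u v} → M * d ≡ k → k * v < u * d → ∀ n → M ^ n * v ^ n ≤ u ^ n
upperRate {M} {d} {k} {u} {v} M*d≡k k*v<u*d n =
  ≡.subst (_≤ u ^ n) (^-distrib-* M v n) (ℕ.^-monoˡ-≤ n (ℕ.<⇒≤ M*v<u))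
  where
  M*v<u : M * v < u
  M*v<u = ℕ.*-cancelʳ-< d (M * v) u
            (≡.subst (_< u * d) (≡.trans (≡.cong (_* v) (≡.sym M*d≡k)) (xy∙z≈xz∙y M d v)) k*v<u*d)

lowerRate : ∀ {M d k u v} → M * d ≡ k → u * d < k * v → ∀ n {r} → M ^ n ≤ r → u ^ n ≤ r * v ^ n
lowerRate {M} {d} {k} {u} {v} M*d≡k u*d<k*v n {r} Mⁿ≤r = ℕ.≤-trans (ℕ.^-monoˡ-≤ n (ℕ.<⇒≤ u<M*v))
  (ℕ.≤-trans (ℕ.≤-reflexive (^-distrib-* M v n)) (ℕ.*-monoˡ-≤ (v ^ n) Mⁿ≤r))
  where
  u<M*v : u < M * v
  u<M*v = ℕ.*-cancelʳ-< d u (M * v)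
            (≡.subst (u * d <_) (≡.trans (≡.cong (_* v) (≡.sym M*d≡k)) (xy∙z≈xz∙y M d v)) u*d<k*v)

corollary3p6 : ∀ {ℓ₁ ℓ₂} (F : CommutativeRing ℓ₁ ℓ₂) → IsField F →
    (a b c : ℕ) → .{{NonZero a}} → .{{NonZero b}} → .{{NonZero c}} →
    -- limsup_n S(⟨a,b,c⟩^{⊗n})^{1/n} = abc / max{a,b,c}, stated via rationals u/v:
    -- (upper) for every rational u/v > abc/max, eventually S(T^{⊗n}) ≤ (u/v)^n;
    ((u v : ℕ) → .{{NonZero v}} → a * b * c * v < u * (a ⊔ b ⊔ c) →
      ∃[ N ] ((n : ℕ) → N ≤ n →
        ∃[ r ] (r * v ^ n ≤ u ^ n × HasSliceRankDecomp F (tensorPow F (MM F a b c) n) r)))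
    ×
    -- (lower) for every rational u/v < abc/max, infinitely often S(T^{⊗n}) ≥ (u/v)^n.
    ((u v : ℕ) → .{{NonZero v}} → u * (a ⊔ b ⊔ c) < a * b * c * v →
      (N : ℕ) → ∃[ n ] (N ≤ n × ((r : ℕ) →
        HasSliceRankDecomp F (tensorPow F (MM F a b c) n) r → u ^ n ≤ r * v ^ n)))
corollary3p6 F isField a b c =
  let (M , (upper , lower) , M*max≡abc) = exactPowers F isField a b c in
  (λ u v abc*v<u*max → 0 , λ n _ → M ^ n , upperRate M*max≡abc abc*v<u*max n , upper n) ,
  (λ u v u*max<abc*v N → N , ℕ.≤-refl , λ r D → lowerRate M*max≡abc u*max<abc*v N (lower N r D))
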